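{- Let $\mathbf A$ be a girale. Then for every $a\in A$, the filter of $\mathbf A$ generated by $a$ equals the principal lattice filter $[!a)=\{b\in A: !a\le b\}$. In particular every principal filter of $\mathbf A$ is principal as a lattice filter.
   Context: A commutative residuated lattice is $\langle A,\vee,\wedge,\to,\cdot,1\rangle$ with $\langle A,\vee,\wedge\rangle$ a lattice, $\langle A,\cdot,1\rangle$ a commutative monoid, and $x\cdot y\le z$ iff $x\le y\to z$. A Girard algebra is a commutative residuated lattice with a constant $0$ with $(b\to 0)\to 0=b$ for all $b$. A girale is a Girard algebra with a unary operation $!$ satisfying (G1) $!1=1$; (G2) $!a\le a\wedge 1$; (G3) $!a\cdot !b=!(a\wedge b)$; (G4) $!!a=!a$. A filter of a girale $\mathbf A$ is a subset $F\subseteq A$ that is a lattice filter, contains $1$, satisfies ($a\in F$ and $a\to b\in F$ imply $b\in F$), and is closed under $!$. -}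

module Defs where

open import Level using (Level; suc; _⊔_)
open import Relation.Binary.PropositionalEquality using (_≡_)
open import Data.Product using (_×_)

record Girale (c : Level) : Set (suc c) where
  infixr 7 _·_
  infixr 6 _∧_
  infixr 5 _∨_
  infixr 4 _⇒_
  field
    Carrier : Set c
    _∨_ _∧_ _⇒_ _·_ : Carrier → Carrier → Carrier
    1# 0# : Carrier
    ! : Carrier → Carrier
    ∨-comm : ∀ x y → (x ∨ y) ≡ (y ∨ x)
    ∧-comm : ∀ x y → (x ∧ y) ≡ (y ∧ x)
    ∨-assoc : ∀ x y z → ((x ∨ y) ∨ z) ≡ (x ∨ (y ∨ z))
    ∧-assoc : ∀ x y z → ((x ∧ y) ∧ z) ≡ (x ∧ (y ∧ z))
    ∨-absorbs-∧ : ∀ x y → (x ∨ (x ∧ y)) ≡ x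
    ∧-absorbs-∨ : ∀ x y → (x ∧ (x ∨ y)) ≡ x
    ·-comm : ∀ x y → (x · y) ≡ (y · x)
    ·-assoc : ∀ x y z → ((x · y) · z) ≡ (x · (y · z))
    ·-identityˡ : ∀ x → (1# · x) ≡ x
    -- residuation: x · y ≤ z iff x ≤ y ⇒ z
    residuated₁ : ∀ x y z → ((x · y) ∧ z) ≡ (x · y) → (x ∧ (y ⇒ z)) ≡ x
    residuated₂ : ∀ x y z → (x ∧ (y ⇒ z)) ≡ x → ((x · y) ∧ z) ≡ (x · y)
    involutive : ∀ b → ((b ⇒ 0#) ⇒ 0#) ≡ b
    G1 : ! 1# ≡ 1#
    G2 : ∀ a → (! a ∧ (a ∧ 1#)) ≡ ! a
    G3 : ∀ a b → (! a · ! b) ≡ ! (a ∧ b)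
    G4 : ∀ a → ! (! a) ≡ ! a

  _≤_ : Carrier → Carrier → Set c
  x ≤ y = (x ∧ y) ≡ x

  record IsFilter (F : Carrier → Set c) : Set c where
    field
      upward : ∀ {x y} → F x → x ≤ y → F y
      meet : ∀ {x y} → F x → F y → F (x ∧ y)
      one : F 1#
      mp : ∀ {x y} → F x → F (x ⇒ y) → F y
      bang : ∀ {x} → F x → F (! x)

  Generated : Carrier → Carrier → Set (suc c)
  Generated a b = (F : Carrier → Set c) → IsFilter F → F a → F b

  Principal : Carrier → Carrier → Set c
  Principal x b = x ≤ b

{-# OPTIONS --safe #-}
module Submission where

open import Defs
open import Level using (Level)
open import Data.Product using (_×_; _,_)
open import Relation.Binary.PropositionalEquality
open import Algebra.Lattice.Bundles using (Lattice)
import Algebra.Lattice.Structures as LatticeStructures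
import Algebra.Lattice.Properties.Lattice as LatticeProperties
import Relation.Binary.Construct.NaturalOrder.Left as NaturalOrder

-- [!a) is itself a filter: it is closed under ! by monotonicity of ! and G4,
-- and under modus ponens because !a · !a = !(a ∧ a) = !a (G3), so that
-- !a ≤ x and !a ≤ x ⇒ y give !a ≤ (x ⇒ y) · x ≤ y.  It contains a by G2, and
-- every filter containing a contains !a, hence all of [!a).

module GiraleProperties {c : Level} (A : Girale c) where
  open Girale A
  open LatticeStructures {A = Carrier} _≡_ using (IsLattice)
  open NaturalOrder {A = Carrier} _≡_ _∧_ using (x∙y≤x; x∙y≤y; ∙-presʳ-≤)
    renaming (trans to ≤ₗ-trans)

  ∨-∧-isLattice : IsLattice _∨_ _∧_
  ∨-∧-isLattice = record
    { isEquivalence = isEquivalence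
    ; ∨-comm = ∨-comm
    ; ∨-assoc = ∨-assoc
    ; ∨-cong = cong₂ _∨_
    ; ∧-comm = ∧-comm
    ; ∧-assoc = ∧-assoc
    ; ∧-cong = cong₂ _∧_
    ; absorptive = ∨-absorbs-∧ , ∧-absorbs-∨
    }

  lattice : Lattice c c
  lattice = record { isLattice = ∨-∧-isLattice }

  open LatticeProperties lattice using (∧-idem; ∧-isSemigroup; ∧-isSemilattice)

  -- x ≤ y is the library's left natural order x ≡ x ∧ y read backwards.
  ≤-refl : ∀ x → x ≤ x
  ≤-refl = ∧-idem

  ≤-trans : ∀ {x y z} → x ≤ y → y ≤ z → x ≤ z
  ≤-trans p q = sym (≤ₗ-trans ∧-isSemigroup (sym p) (sym q))

  x∧y≤x : ∀ x y → (x ∧ y) ≤ x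
  x∧y≤x x y = sym (x∙y≤x ∧-isSemilattice x y)

  x∧y≤y : ∀ x y → (x ∧ y) ≤ y
  x∧y≤y x y = sym (x∙y≤y ∧-isSemilattice x y)

  ∧-greatest : ∀ {x y z} → z ≤ x → z ≤ y → z ≤ (x ∧ y)
  ∧-greatest {z = z} p q =
    sym (∙-presʳ-≤ ∧-isSemilattice z (sym p) (sym q))

  ·-monoˡ-≤ : ∀ {x y} z → x ≤ y → (x · z) ≤ (y · z)
  ·-monoˡ-≤ {x} {y} z x≤y = residuated₂ x z (y · z)
    (≤-trans x≤y (residuated₁ y z (y · z) (≤-refl (y · z))))

  ·-monoʳ-≤ : ∀ {x y} z → x ≤ y → (z · x) ≤ (z · y)
  ·-monoʳ-≤ {x} {y} z x≤y
    rewrite ·-comm z x | ·-comm z y = ·-monoˡ-≤ z x≤y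

  ⇒-eval : ∀ x y → ((x ⇒ y) · x) ≤ y
  ⇒-eval x y = residuated₂ (x ⇒ y) x y (≤-refl (x ⇒ y))

  !x≤x : ∀ x → ! x ≤ x
  !x≤x x = ≤-trans (G2 x) (x∧y≤x x 1#)

  !x≤1 : ∀ x → ! x ≤ 1#
  !x≤1 x = ≤-trans (G2 x) (x∧y≤y x 1#)

  !-mono-≤ : ∀ {x y} → x ≤ y → ! x ≤ ! y
  !-mono-≤ {x} {y} x≤y = subst (λ t → ! t ≤ ! y) x≤y
    (subst₂ _≤_ (G3 x y) (·-identityˡ (! y)) (·-monoˡ-≤ (! y) (!x≤1 x)))

  !-·-idem : ∀ x → (! x · ! x) ≡ ! x
  !-·-idem x = trans (G3 x x) (cong ! (∧-idem x))

  principal-!-isFilter : ∀ a → IsFilter (Principal (! a))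
  principal-!-isFilter a = record
    { upward = ≤-trans
    ; meet = ∧-greatest
    ; one = !x≤1 a
    ; mp = λ {x} {y} !a≤x !a≤x⇒y → subst (_≤ y) (!-·-idem a)
        (≤-trans (·-monoʳ-≤ (! a) !a≤x)
          (≤-trans (·-monoˡ-≤ x !a≤x⇒y) (⇒-eval x y)))
    ; bang = λ {x} !a≤x → subst (_≤ ! x) (G4 a) (!-mono-≤ !a≤x)
    }

  principal-!⊆filter : ∀ {F a b} → IsFilter F → F a → Principal (! a) b → F b
  principal-!⊆filter isF Fa = IsFilter.upward isF (IsFilter.bang isF Fa)

mainTheorem14 : ∀ {c : Level} (A : Girale c) → let open Girale A in ∀ (a b : Carrier) → (Generated a b → Principal (! a) b) × (Principal (! a) b → Generated a b)
mainTheorem14 A a b =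
  (λ generated → generated (Principal (! a)) (principal-!-isFilter a) (!x≤x a)) ,
  (λ !a≤b F isF Fa → principal-!⊆filter isF Fa !a≤b)
  where
  open Girale A
  open GiraleProperties A
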